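{- Let $\mathcal R$ be a TRS, and let $\mu_{\mathsf i}$ and $\mu_{\mathsf t}$ be its innermost usable replacement map and its usable replacement map, respectively. Then: (i) every term $t$ with $s \,(\xrightarrow{i}_{\mathcal R})^{*}\, t$ for some $s\in\mathcal T(\varnothing)$ belongs to $\mathcal T(\mu_{\mathsf i})$; (ii) every term $t$ with $s \to_{\mathcal R}^{*} t$ for some $s\in\mathcal T(\varnothing)$ belongs to $\mathcal T(\mu_{\mathsf t})$.
   Context: Let $\mathcal F$ be a finite signature and $\mathcal V$ a countably infinite set of variables; $\mathcal T(\mathcal F,\mathcal V)$ is the set of terms. A TRS $\mathcal R$ is a finite set of rules $l\to r$ with $l\notin\mathcal V$ and $\mathrm{Var}(r)\subseteq\mathrm{Var}(l)$; $\to_{\mathcal R}$ is its rewrite relation, $\mathrm{NF}(\mathcal R)$ its set of normal forms. The innermost rewrite relation: $s\xrightarrow{i}_{\mathcal R}t$ iff $s=C[l\sigma]$, $t=C[r\sigma]$ for a rule $l\to r\in\mathcal R$, a context $C$ and a substitution $\sigma$ such that all proper subterms of $l\sigma$ are in $\mathrm{NF}(\mathcal R)$. A replacement map $\mu$ assigns to each $n$-ary symbol $f$ ($n\ge 1$) a set $\mu(f)\subseteq\{1,\dots,n\}$; it is identified with the set of pairs $(f,i)$ with $i\in\mu(f)$, and replacement maps are ordered by inclusion. The $\mu$-replacing positions are $\mathrm{Pos}_\mu(x)=\{\epsilon\}$ for variables $x$ and $\mathrm{Pos}_\mu(f(t_1,\dots,t_n))=\{\epsilon\}\cup\{ip\mid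 i\in\mu(f),\ p\in\mathrm{Pos}_\mu(t_i)\}$; $\mathrm{NPos}_\mu(t)=\mathrm{Pos}(t)\setminus\mathrm{Pos}_\mu(t)$. $\mathcal T(\mu)$ is the set of terms $t$ such that for every position $p$ of $t$, $t|_p\notin\mathrm{NF}(\mathcal R)$ implies $p\in\mathrm{Pos}_\mu(t)$. For terms $s,t$, $\mathrm{CAP}^s_\mu(t)$ is defined recursively on $t$: it is $t$ if $t=s|_p$ for some $p\in\mathrm{NPos}_\mu(s)$; otherwise, if $t=f(t_1,\dots,t_n)$ and $u:=f(\mathrm{CAP}^s_\mu(t_1),\dots,\mathrm{CAP}^s_\mu(t_n))$ unifies with no left-hand side $l$ of a rule of $\mathcal R$ (variables of $l$ renamed apart from $u$), it is $u$; in all other cases it is a fresh variable. Define $\Upsilon(\mu)=\{(f,i)\mid \text{there is } l\to r\in\mathcal R \text{ and a subterm } f(r_1,\dots,r_n) \text{ of } r \text{ with } \mathrm{CAP}^l_\mu(r_i)\neq r_i\}$. $\Upsilon$ is monotone; the innermost usable replacement map is $\mu_{\mathsf i}=\Upsilon(\varnothing)$ and the usable replacement map $\mu_{\mathsf t}$ is the least fixed point of $\Upsilon$. -}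

module Defs where

open import Data.Nat using (ℕ)
open import Data.Fin using (Fin; toℕ)
open import Data.Vec using (Vec; []; _∷_; lookup; _[_]≔_)
open import Data.List using (List; []; _∷_; _++_; [_])
open import Data.List.Membership.Propositional using (_∈_)
open import Data.Bool using (Bool; true; false)
open import Data.Sum using (_⊎_; inj₁; inj₂)
open import Data.Product using (Σ; ∃; ∃-syntax; _×_)
open import Relation.Nullary using (¬_)
open import Relation.Binary.PropositionalEquality using (_≡_; _≢_)
open import Relation.Binary.Construct.Closure.ReflexiveTransitive using (Star)
open import Function.Bundles using (_⇔_)

record Signature : Set where
  field
    nsym  : ℕ
    arity : Fin nsym → ℕ
open Signature public

data Term (F : Signature) (V : Set) : Set where
  var : V → Term F V
  fun : (f : Fin (nsym F)) → Vec (Term F V) (arity F f) → Term F V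

-- Positions: lists of argument indices (0-based: argument i is toℕ i).
Pos : Set
Pos = List ℕ

module _ {F : Signature} where

  mutual
    _·_ : {V W : Set} → Term F V → (V → Term F W) → Term F W
    var x    · σ = σ x
    fun f ts · σ = fun f (ts ·s σ)

    _·s_ : {V W : Set} {n : ℕ} → Vec (Term F V) n → (V → Term F W) → Vec (Term F W) n
    []       ·s σ = []
    (t ∷ ts) ·s σ = (t · σ) ∷ (ts ·s σ)

  embed : {V W : Set} → Term F V → Term F (V ⊎ W)
  embed t = t · (λ x → var (inj₁ x))

  data Occurs {V : Set} (x : V) : Term F V → Set where
    here  : Occurs x (var x)
    there : ∀ {f ts} (i : Fin (arity F f)) → Occurs x (lookup ts i) → Occurs x (fun f ts)

  data SubtermAt {V : Set} : Term F V → Pos → Term F V → Set where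
    at-root : ∀ {t} → SubtermAt t [] t
    at-arg  : ∀ {f ts p u} (i : Fin (arity F f)) →
              SubtermAt (lookup ts i) p u → SubtermAt (fun f ts) (toℕ i ∷ p) u

module _ (F : Signature) where

  record Rule : Set where
    field
      lhs       : Term F ℕ
      rhs       : Term F ℕ
      lhs-fun   : ∃[ f ] ∃[ ts ] (lhs ≡ fun f ts)
      rhs-vars  : ∀ x → Occurs x rhs → Occurs x lhs
  open Rule public

  TRS : Set
  TRS = List Rule

  -- Replacement maps: μ f i = true iff i ∈ μ(f).
  RMap : Set
  RMap = (f : Fin (nsym F)) → Fin (arity F f) → Bool

  ∅ : RMap
  ∅ _ _ = false

  _⊆ₘ_ : RMap → RMap → Set
  μ ⊆ₘ ν = ∀ f i → μ f i ≡ true → ν f i ≡ true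

module _ {F : Signature} where

  data Step (R : TRS F) : Term F ℕ → Term F ℕ → Set where
    root : ∀ (ρ : Rule F) → ρ ∈ R → (σ : ℕ → Term F ℕ) →
           Step R (lhs ρ · σ) (rhs ρ · σ)
    cong : ∀ {f ts t'} (i : Fin (arity F f)) → Step R (lookup ts i) t' →
           Step R (fun f ts) (fun f (ts [ i ]≔ t'))

  NF : TRS F → Term F ℕ → Set
  NF R t = ¬ (∃[ t' ] Step R t t')

  data IStep (R : TRS F) : Term F ℕ → Term F ℕ → Set where
    root : ∀ (ρ : Rule F) → ρ ∈ R → (σ : ℕ → Term F ℕ) →
           (∀ p u → SubtermAt (lhs ρ · σ) p u → p ≢ [] → NF R u) →
           IStep R (lhs ρ · σ) (rhs ρ · σ)
    cong : ∀ {f ts t'} (i : Fin (arity F f)) → IStep R (lookup ts i) t' →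
           IStep R (fun f ts) (fun f (ts [ i ]≔ t'))

  data PosMu {V : Set} (μ : RMap F) : Term F V → Pos → Set where
    pos-root : ∀ {t} → PosMu μ t []
    pos-arg  : ∀ {f ts p} (i : Fin (arity F f)) → μ f i ≡ true →
               PosMu μ (lookup ts i) p → PosMu μ (fun f ts) (toℕ i ∷ p)

  InT : TRS F → RMap F → Term F ℕ → Set
  InT R μ t = ∀ p u → SubtermAt t p u → ¬ NF R u → PosMu μ t p

  -- u (over variables V) unifies with l, variables of l renamed apart
  -- (equivalently: separate substitutions for u and for l).
  Unifiable : {V : Set} → Term F V → Term F ℕ → Set
  Unifiable {V} u l =
    Σ (V → Term F ℕ) λ σ → Σ (ℕ → Term F ℕ) λ τ → (u · σ ≡ l · τ)

  AtNPos : RMap F → Term F ℕ → Term F ℕ → Set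
  AtNPos μ s t = ∃[ p ] (SubtermAt s p t × ¬ PosMu μ s p)

  -- CAP^s_μ, as a (functional) relation.  The output has variables ℕ ⊎ Pos:
  -- the original variables are inj₁ x, and the fresh variable introduced at
  -- position q of the argument term is inj₂ q (so all fresh variables are
  -- pairwise distinct and distinct from all original variables).
  -- Cap R μ s q t c : c = CAP^s_μ(t), where t sits at position q.
  mutual
    data Cap (R : TRS F) (μ : RMap F) (s : Term F ℕ) (q : Pos) :
             Term F ℕ → Term F (ℕ ⊎ Pos) → Set where
      cap-keep  : ∀ {t} → AtNPos μ s t → Cap R μ s q t (embed t)
      cap-fun   : ∀ {f ts cs} → ¬ AtNPos μ s (fun f ts) →
                  Caps R μ s q ts cs →
                  (∀ ρ → ρ ∈ R → ¬ Unifiable (fun f cs) (lhs ρ)) →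
                  Cap R μ s q (fun f ts) (fun f cs)
      cap-unif  : ∀ {f ts cs} → ¬ AtNPos μ s (fun f ts) →
                  Caps R μ s q ts cs →
                  (∃[ ρ ] (ρ ∈ R × Unifiable (fun f cs) (lhs ρ))) →
                  Cap R μ s q (fun f ts) (var (inj₂ q))
      cap-var   : ∀ {x} → ¬ AtNPos μ s (var x) →
                  Cap R μ s q (var x) (var (inj₂ q))

    Caps : (R : TRS F) (μ : RMap F) (s : Term F ℕ) (q : Pos) {n : ℕ} →
           Vec (Term F ℕ) n → Vec (Term F (ℕ ⊎ Pos)) n → Set
    Caps R μ s q {n} ts cs = ∀ (i : Fin n) → Cap R μ s (q ++ [ toℕ i ]) (lookup ts i) (lookup cs i)

  Υ : TRS F → RMap F → (f : Fin (nsym F)) → Fin (arity F f) → Set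
  Υ R μ f i = ∃[ ρ ] (ρ ∈ R × ∃[ q ] ∃[ rs ] (SubtermAt (rhs ρ) q (fun f rs) ×
                 ∃[ c ] (Cap R μ (lhs ρ) [] (lookup rs i) c × c ≢ embed (lookup rs i))))

  FixΥ : TRS F → RMap F → Set
  FixΥ R μ = ∀ f i → (μ f i ≡ true) ⇔ Υ R μ f i

  LeastFixΥ : TRS F → RMap F → Set
  LeastFixΥ R μ = FixΥ R μ × (∀ ν → FixΥ R ν → _⊆ₘ_ F μ ν)

-- A rewrite step preserves T(μ) as soon as Υ(μ) ⊆ μ, and an innermost step as soon as
-- Υ(∅) ⊆ μ; moreover T(∅) ⊆ T(μ).  A step below the root takes place at a non-normal,
-- hence μ-replacing, position.  After a root step lσ → rσ, a non-normal subterm of rσ lies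
-- either inside some σ(x), which already occurs in lσ, or at the instance of a position of r.
-- Along the path to the latter every argument rᵢ has rᵢσ non-normal, so CAP^l_μ(rᵢ) ≠ rᵢ:
-- if rᵢ were left uncapped, rᵢσ would be normal, because no left-hand side unifies with an
-- uncapped subterm and the subterms that CAP keeps sit at non-μ-replacing positions of
-- lσ ∈ T(μ).  Hence (f, i) ∈ Υ(μ) ⊆ μ.  For an innermost step the proper subterms of lσ are
-- normal, which serves for CAP^l_∅ and also makes every σ(x) normal.
module Submission where

open import Defs
open import Data.Product using (_×_)
open import Data.Bool using (true)
open import Relation.Binary.PropositionalEquality using (_≡_)
open import Relation.Binary.Construct.Closure.ReflexiveTransitive using (Star)
open import Function.Bundles using (_⇔_)

open import Data.Nat using (ℕ)
open import Data.Fin using (Fin; toℕ; zero; suc; _≟_)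
open import Data.Fin.Properties using (toℕ-injective)
open import Data.Vec using (Vec; []; _∷_; lookup; _[_]≔_)
open import Data.Vec.Properties using (lookup∘update; lookup∘update′)
open import Data.List using ([]; _∷_; _++_; [_])
open import Data.List.Properties using (++-conicalˡ)
open import Data.List.Membership.Propositional using (_∈_)
open import Data.Bool.Properties using () renaming (_≟_ to _≟ᵇ_)
open import Data.Sum using (_⊎_; [_,_]′)
open import Data.Product using (∃-syntax; _,_; proj₁; proj₂)
open import Data.Empty using (⊥-elim)
open import Function using (id; _∘_)
open import Function.Bundles using (Equivalence)
open import Relation.Nullary using (¬_; yes; no)
open import Relation.Nullary.Decidable using (decidable-stable; ¬¬-excluded-middle)
open import Relation.Binary.Definitions using (_Respects_)
open import Relation.Binary.PropositionalEquality using (_≢_; refl; sym; trans; subst)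
open import Relation.Binary.Construct.Closure.ReflexiveTransitive using (fold)

Star-respects : {I : Set} {T : I → I → Set} (P : I → Set) → P Respects T → P Respects Star T
Star-respects P step = fold (λ i j → P i → P j) (λ s k → k ∘ step s) id

module _ {F : Signature} where

  mutual
    ·-assoc : {U V W : Set} (t : Term F U) (g : U → Term F V) (h : V → Term F W) →
              (t · g) · h ≡ t · (λ x → g x · h)
    ·-assoc (var x)    g h = refl
    ·-assoc (fun f ts) g h rewrite ·s-assoc ts g h = refl

    ·s-assoc : {U V W : Set} {n : ℕ} (ts : Vec (Term F U) n) (g : U → Term F V) (h : V → Term F W) →
               (ts ·s g) ·s h ≡ ts ·s (λ x → g x · h)
    ·s-assoc []       g h = refl
    ·s-assoc (t ∷ ts) g h rewrite ·-assoc t g h | ·s-assoc ts g h = refl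

  lookup-·s : {V W : Set} {n : ℕ} (ts : Vec (Term F V) n) (σ : V → Term F W) (i : Fin n) →
              lookup (ts ·s σ) i ≡ lookup ts i · σ
  lookup-·s (t ∷ ts) σ zero    = refl
  lookup-·s (t ∷ ts) σ (suc i) = lookup-·s ts σ i

  SubtermAt-++ : {V : Set} {t u v : Term F V} {p q : Pos} →
                 SubtermAt t p u → SubtermAt u q v → SubtermAt t (p ++ q) v
  SubtermAt-++ at-root      s = s
  SubtermAt-++ (at-arg i r) s = at-arg i (SubtermAt-++ r s)

  SubtermAt-· : {V W : Set} {t u : Term F V} {p : Pos} (σ : V → Term F W) →
                SubtermAt t p u → SubtermAt (t · σ) p (u · σ)
  SubtermAt-· σ at-root = at-root
  SubtermAt-· {t = fun f ts} σ (at-arg i s) =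
    at-arg i (subst (λ v → SubtermAt v _ _) (sym (lookup-·s ts σ i)) (SubtermAt-· σ s))

  SubtermAt-var⇒Occurs : {V : Set} {t : Term F V} {p : Pos} {x : V} → SubtermAt t p (var x) → Occurs x t
  SubtermAt-var⇒Occurs at-root      = here
  SubtermAt-var⇒Occurs (at-arg i s) = there i (SubtermAt-var⇒Occurs s)

  Occurs⇒SubtermAt-var : {V : Set} {t : Term F V} {x : V} → Occurs x t → ∃[ p ] SubtermAt t p (var x)
  Occurs⇒SubtermAt-var here = [] , at-root
  Occurs⇒SubtermAt-var (there i o) with Occurs⇒SubtermAt-var o
  ... | p , s = toℕ i ∷ p , at-arg i s

  SubtermAt-root : {V : Set} {t u : Term F V} → SubtermAt t [] u → t ≡ u
  SubtermAt-root at-root = refl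

  PosMu-arg⁻ : {V : Set} {μ : RMap F} {f : Fin (nsym F)} {ts : Vec (Term F V) (arity F f)} {p : Pos} →
               (i : Fin (arity F f)) → PosMu μ (fun f ts) (toℕ i ∷ p) → μ f i ≡ true × PosMu μ (lookup ts i) p
  PosMu-arg⁻ {μ = μ} {f} {ts} i pm = invert pm refl
    where
    invert : ∀ {k p} → PosMu μ (fun f ts) (k ∷ p) → toℕ i ≡ k → μ f i ≡ true × PosMu μ (lookup ts i) p
    invert (pos-arg j e pm) eq with toℕ-injective eq
    ... | refl = e , pm

  PosMu-drop : {V : Set} {μ : RMap F} {t u : Term F V} {p q : Pos} →
               SubtermAt t p u → PosMu μ t (p ++ q) → PosMu μ u q
  PosMu-drop at-root      pm = pm
  PosMu-drop (at-arg i s) pm = PosMu-drop s (proj₂ (PosMu-arg⁻ i pm))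

  PosMu-unsubst : {V W : Set} {μ : RMap F} {l u : Term F V} {p : Pos} (σ : V → Term F W) →
                  SubtermAt l p u → PosMu μ (l · σ) p → PosMu μ l p
  PosMu-unsubst σ at-root pm = pos-root
  PosMu-unsubst {l = fun f ts} σ (at-arg i s) pm with PosMu-arg⁻ i pm
  ... | e , pm′ = pos-arg i e (PosMu-unsubst σ s (subst (λ v → PosMu _ v _) (lookup-·s ts σ i) pm′))

  PosMu-mono : {V : Set} {μ ν : RMap F} {t : Term F V} {p : Pos} → _⊆ₘ_ F μ ν → PosMu μ t p → PosMu ν t p
  PosMu-mono μ⊆ν pos-root           = pos-root
  PosMu-mono μ⊆ν (pos-arg {f} i e pm) = pos-arg i (μ⊆ν f i e) (PosMu-mono μ⊆ν pm)

module _ {F : Signature} (R : TRS F) where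

  private
    T : Set
    T = Term F ℕ

  NF-subterm : {t u : T} {p : Pos} → NF R t → SubtermAt t p u → NF R u
  NF-subterm nf at-root = nf
  NF-subterm nf (at-arg i s) = NF-subterm (λ { (_ , st) → nf (_ , cong i st) }) s

  IStep⇒Step : {s t : T} → IStep R s t → Step R s t
  IStep⇒Step (root ρ m σ _) = root ρ m σ
  IStep⇒Step (cong i st)    = cong i (IStep⇒Step st)

  -- Totality only up to double negation: unifiability is not decided here.
  mutual
    Cap-total : (μ : RMap F) (l : T) (q : Pos) (u : T) → ¬ ¬ (∃[ c ] Cap R μ l q u c)
    Cap-total μ l q u k = ¬¬-excluded-middle {A = AtNPos μ l u} λ
      { (yes a)  → k (_ , cap-keep a)
      ; (no ¬a) → Cap-total-capped μ l q u ¬a k }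

    Cap-total-capped : (μ : RMap F) (l : T) (q : Pos) (u : T) → ¬ AtNPos μ l u →
                       ¬ ¬ (∃[ c ] Cap R μ l q u c)
    Cap-total-capped μ l q (var x) ¬a k = k (_ , cap-var ¬a)
    Cap-total-capped μ l q (fun f us) ¬a k =
      Caps-total μ l (λ i → q ++ [ toℕ i ]) us λ { (cs , caps) →
        ¬¬-excluded-middle {A = ∃[ ρ ] (ρ ∈ R × Unifiable (fun f cs) (lhs ρ))} λ
        { (yes unif)  → k (_ , cap-unif ¬a caps unif)
        ; (no ¬unif) → k (_ , cap-fun ¬a caps (λ ρ m un → ¬unif (ρ , m , un))) } }

    Caps-total : (μ : RMap F) (l : T) {n : ℕ} (q : Fin n → Pos) (us : Vec T n) →
                 ¬ ¬ (∃[ cs ] (∀ i → Cap R μ l (q i) (lookup us i) (lookup cs i)))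
    Caps-total μ l q []       k = k ([] , λ ())
    Caps-total μ l q (u ∷ us) k =
      Cap-total μ l (q zero) u λ { (c , cap) →
      Caps-total μ l (q ∘ suc) us λ { (cs , caps) →
      k (c ∷ cs , λ { zero → cap ; (suc i) → caps i }) } }

  Cap-identity⇒NF : {μ : RMap F} {l : T} (σ : ℕ → T) →
                    (∀ u → AtNPos μ l u → NF R (u · σ)) →
                    {q : Pos} {u : T} {c : Term F (ℕ ⊎ Pos)} → Cap R μ l q u c → c ≡ embed u → NF R (u · σ)
  Cap-identity⇒NF σ nonReplacing⇒NF (cap-keep a) _ = nonReplacing⇒NF _ a
  Cap-identity⇒NF σ nonReplacing⇒NF {u = fun f us} (cap-fun _ caps ¬unif) refl (_ , st) =
    irreducible st refl
    where
    irreducible : ∀ {t t′} → Step R t t′ → t ≢ fun f us · σ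
    irreducible (root ρ m τ) eq =
      ¬unif ρ m ([ σ , (λ _ → var 0) ]′ , τ , trans (·-assoc (fun f us) _ _) (sym eq))
    irreducible (cong i st) refl =
      Cap-identity⇒NF σ nonReplacing⇒NF (caps i) (lookup-·s us _ i)
        (_ , subst (λ v → Step R v _) (lookup-·s us σ i) st)
  Cap-identity⇒NF σ nonReplacing⇒NF (cap-unif _ _ _) ()
  Cap-identity⇒NF σ nonReplacing⇒NF (cap-var _)      ()

  InT-subterm : {μ : RMap F} {t u : T} {p : Pos} → InT R μ t → SubtermAt t p u → InT R μ u
  InT-subterm hs s q w s′ ¬nf = PosMu-drop s (hs _ w (SubtermAt-++ s s′) ¬nf)

  InT-replacing : {μ : RMap F} {f : Fin (nsym F)} {ts : Vec T (arity F f)} (i : Fin (arity F f)) →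
                  InT R μ (fun f ts) → ¬ NF R (lookup ts i) → μ f i ≡ true
  InT-replacing i hs ¬nf = proj₁ (PosMu-arg⁻ i (hs _ _ (at-arg i at-root) ¬nf))

  InT-fun : {μ : RMap F} {f : Fin (nsym F)} {ts : Vec T (arity F f)} →
            (∀ i → ¬ NF R (lookup ts i) → μ f i ≡ true) → (∀ i → InT R μ (lookup ts i)) →
            InT R μ (fun f ts)
  InT-fun replacing args []            w at-root      ¬nf = pos-root
  InT-fun replacing args (.(toℕ i) ∷ p) w (at-arg i s) ¬nf =
    pos-arg i (replacing i (λ nf → ¬nf (NF-subterm nf s))) (args i p w s ¬nf)

  InT-mono : {μ ν : RMap F} {t : T} → _⊆ₘ_ F μ ν → InT R μ t → InT R ν t
  InT-mono μ⊆ν hs p w s ¬nf = PosMu-mono μ⊆ν (hs p w s ¬nf)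

  InT-cong : {μ : RMap F} {f : Fin (nsym F)} {ts : Vec T (arity F f)} {j : Fin (arity F f)} {t′ : T} →
             InT R μ (fun f ts) → ¬ NF R (lookup ts j) → (InT R μ (lookup ts j) → InT R μ t′) →
             InT R μ (fun f (ts [ j ]≔ t′))
  InT-cong {μ} {f} {ts} {j} {t′} hs ¬nf preserve = InT-fun replacing args
    where
    replacing : ∀ i → ¬ NF R (lookup (ts [ j ]≔ t′) i) → μ f i ≡ true
    replacing i with i ≟ j
    ... | yes refl = λ _ → InT-replacing i hs ¬nf
    ... | no i≢j rewrite lookup∘update′ i≢j ts t′ = InT-replacing i hs
    args : ∀ i → InT R μ (lookup (ts [ j ]≔ t′) i)
    args i with i ≟ j
    ... | yes refl rewrite lookup∘update i ts t′ = preserve (InT-subterm hs (at-arg i at-root))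
    ... | no i≢j  rewrite lookup∘update′ i≢j ts t′ = InT-subterm hs (at-arg i at-root)

  InT-contractum : {μc μ : RMap F} → (∀ f i → Υ R μc f i → μ f i ≡ true) →
                   {ρ : Rule F} → ρ ∈ R → (σ : ℕ → T) →
                   (∀ u → AtNPos μc (lhs ρ) u → NF R (u · σ)) →
                   (∀ x → Occurs x (lhs ρ) → InT R μ (σ x)) →
                   InT R μ (rhs ρ · σ)
  InT-contractum {μc} {μ} Υ⊆μ {ρ} m σ nonReplacing⇒NF variables = below (rhs ρ) [] at-root
    where
    mutual
      below : ∀ r q → SubtermAt (rhs ρ) q r → InT R μ (r · σ)
      below (var x)    q s = variables x (rhs-vars ρ x (SubtermAt-var⇒Occurs s))
      below (fun f rs) q s = InT-fun replacing λ i →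
        subst (InT R μ) (sym (lookup-·s rs σ i)) (below-args rs (λ i → SubtermAt-++ s (at-arg i at-root)) i)
        where
        replacing : ∀ i → ¬ NF R (lookup (rs ·s σ) i) → μ f i ≡ true
        replacing i ¬nf = decidable-stable (μ f i ≟ᵇ true) λ μ≢ →
          Cap-total μc (lhs ρ) [] (lookup rs i) λ { (c , cap) →
          μ≢ (Υ⊆μ f i (ρ , m , q , rs , s , c , cap , λ c≡ →
            ¬nf (subst (NF R) (sym (lookup-·s rs σ i)) (Cap-identity⇒NF σ nonReplacing⇒NF cap c≡)))) }

      below-args : {n : ℕ} {q : Fin n → Pos} (rs : Vec T n) → (∀ i → SubtermAt (rhs ρ) (q i) (lookup rs i)) →
                   ∀ i → InT R μ (lookup rs i · σ)
      below-args (r ∷ rs) s zero    = below r _ (s zero)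
      below-args (r ∷ rs) s (suc i) = below-args rs (s ∘ suc) i

  Step-preserves-InT : {μ : RMap F} → (∀ f i → Υ R μ f i → μ f i ≡ true) →
                       InT R μ Respects Step R
  Step-preserves-InT {μ} Υ⊆μ (root ρ m σ) hs = InT-contractum Υ⊆μ m σ nonReplacing⇒NF variables
    where
    nonReplacing⇒NF : ∀ u → AtNPos μ (lhs ρ) u → NF R (u · σ)
    nonReplacing⇒NF u (p , s , p∉) red =
      p∉ (PosMu-unsubst σ s (hs p _ (SubtermAt-· σ s) (λ nf → nf red)))
    variables : ∀ x → Occurs x (lhs ρ) → InT R μ (σ x)
    variables x o = InT-subterm hs (SubtermAt-· σ (proj₂ (Occurs⇒SubtermAt-var o)))
  Step-preserves-InT Υ⊆μ (cong j st) hs =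
    InT-cong hs (λ nf → nf (_ , st)) (Step-preserves-InT Υ⊆μ st)

  IStep-preserves-InT : {μ : RMap F} → (∀ f i → Υ R (∅ F) f i → μ f i ≡ true) →
                        InT R μ Respects IStep R
  IStep-preserves-InT {μ} Υ∅⊆μ (root ρ m σ innermost) hs = InT-contractum Υ∅⊆μ m σ nonRoot⇒NF variables
    where
    nonRoot⇒NF : ∀ u → AtNPos (∅ F) (lhs ρ) u → NF R (u · σ)
    nonRoot⇒NF u (p , s , p∉) = innermost p _ (SubtermAt-· σ s) λ { refl → p∉ pos-root }
    variables : ∀ x → Occurs x (lhs ρ) → InT R μ (σ x)
    variables x o q w s ¬nf with Occurs⇒SubtermAt-var o | lhs-fun ρ
    ... | p , sp | f , ts , l≡ =
      ⊥-elim (¬nf (innermost (p ++ q) w (SubtermAt-++ (SubtermAt-· σ sp) s) p++q≢[]))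
      where
      p++q≢[] : p ++ q ≢ []
      p++q≢[] eq with ++-conicalˡ p q eq
      ... | refl with trans (sym (SubtermAt-root sp)) l≡
      ...   | ()
  IStep-preserves-InT Υ∅⊆μ (cong j st) hs =
    InT-cong hs (λ nf → nf (_ , IStep⇒Step st)) (IStep-preserves-InT Υ∅⊆μ st)

theorem17 : (F : Signature) (R : TRS F) (μi μt : RMap F) →
    (∀ f i → (μi f i ≡ true) ⇔ Υ R (∅ F) f i) →
    LeastFixΥ R μt →
    (∀ s t → InT R (∅ F) s → Star (IStep R) s t → InT R μi t)
    × (∀ s t → InT R (∅ F) s → Star (Step R) s t → InT R μt t)
theorem17 F R μi μt μi≡Υ∅ (μt-fixed , _) =
  (λ s t hs steps → Star-respects (InT R μi) (IStep-preserves-InT R Υ∅⊆μi) steps (InT-mono R ∅⊆ hs)) ,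
  (λ s t hs steps → Star-respects (InT R μt) (Step-preserves-InT R Υμt⊆μt) steps (InT-mono R ∅⊆ hs))
  where
  Υ∅⊆μi : ∀ f i → Υ R (∅ F) f i → μi f i ≡ true
  Υ∅⊆μi f i = Equivalence.from (μi≡Υ∅ f i)
  Υμt⊆μt : ∀ f i → Υ R μt f i → μt f i ≡ true
  Υμt⊆μt f i = Equivalence.from (μt-fixed f i)
  ∅⊆ : {μ : RMap F} → _⊆ₘ_ F (∅ F) μ
  ∅⊆ f i ()
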